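{- Let $n\ge m\ge1$. Then $K_{m,n}$ is strong $m$-cop-win and is not strong $k$-cop-win for any $1\le k\le m-1$. Furthermore, $$\lim_{\ell\to\infty}\operatorname{capt}_m(K_{m,n},\ell)=\begin{cases}2\lceil n/m\rceil-2, & n>m,\\ 1, & n=m.\end{cases}$$
   Context: All graphs are reflexive. The game of $k$ cops and $\ell$ robbers: in round $0$ the cops choose starting vertices, then the robbers choose starting vertices (players may share vertices). In each round $i\ge1$ every cop moves to an adjacent vertex or stays, then every robber moves to an adjacent vertex or stays. Whenever a cop occupies the same vertex as some robbers, those robbers are captured and leave the game. For a $k$-cop-win graph $G$, $\operatorname{capt}_k(G,\ell)$ is the smallest $t$ such that the $k$ cops have a strategy guaranteeing all $\ell$ robbers are captured by round $t$ regardless of the robbers' play. $G$ is strong $k$-cop-win if $\lim_{\ell\to\infty}\operatorname{capt}_k(G,\ell)$ exists (is finite). $K_{m,n}$ is the complete bipartite graph with parts of sizes $m$ and $n$. -}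

module Defs where

open import Data.Nat using (ℕ; zero; suc; _≤_; _∸_; _+_; NonZero)
open import Data.Nat.DivMod using (_/_)
open import Data.Fin using (Fin)
open import Data.Fin.Properties using (any?) renaming (_≟_ to _≟ᶠ_)
open import Data.Sum using (_⊎_; inj₁; inj₂)
open import Data.Sum.Properties using (≡-dec)
open import Data.Maybe using (Maybe; just; nothing)
open import Data.Product using (Σ; ∃; _×_; _,_)
open import Data.Bool using (if_then_else_)
open import Relation.Nullary using (does)
open import Relation.Binary.PropositionalEquality using (_≡_)
open import Relation.Binary.Definitions using (DecidableEquality)

record Graph : Set₁ where
  field
    V      : Set
    _~_    : V → V → Set
    ~-refl : ∀ v → v ~ v
    ~-sym  : ∀ {u v} → u ~ v → v ~ u
    _≟_    : DecidableEquality V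

module Game (G : Graph) where
  open Graph G

  Cops : ℕ → Set
  Cops k = Fin k → V

  -- state of ℓ robbers: nothing = captured (has left the game)
  Robbers : ℕ → Set
  Robbers ℓ = Fin ℓ → Maybe V

  capture : ∀ {k ℓ} → Cops k → Robbers ℓ → Robbers ℓ
  capture {k} c r j with r j
  ... | nothing = nothing
  ... | just v  = if does (any? (λ i → c i ≟ v)) then nothing else just v

  AllCaught : ∀ {ℓ} → Robbers ℓ → Set
  AllCaught r = ∀ j → r j ≡ nothing

  CopMove : ∀ {k} → Cops k → Cops k → Set
  CopMove c c' = ∀ i → c i ~ c' i

  data RStep : Maybe V → Maybe V → Set where
    out  : RStep nothing nothing
    step : ∀ {v w} → v ~ w → RStep (just v) (just w)

  RobMove : ∀ {ℓ} → Robbers ℓ → Robbers ℓ → Set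
  RobMove r r' = ∀ j → RStep (r j) (r' j)

  -- From a position at the end of a round, the cops can guarantee that
  -- all robbers are captured within t further rounds.
  WinIn : ∀ {k ℓ} → ℕ → Cops k → Robbers ℓ → Set
  WinIn zero    c r = AllCaught r
  WinIn (suc t) c r =
    Σ (Cops _) λ c' → CopMove c c' ×
      (∀ r' → RobMove (capture c' r) r' → WinIn t c' (capture c' r'))

  -- k cops can guarantee capture of all ℓ robbers by round t
  -- (round 0: cops place, then robbers place).
  CaptLe : (k ℓ t : ℕ) → Set
  CaptLe k ℓ t = Σ (Cops k) λ c₀ → ∀ (r₀ : Fin ℓ → V) →
    WinIn t c₀ (capture c₀ (λ j → just (r₀ j)))

  IsCapt : (k ℓ t : ℕ) → Set
  IsCapt k ℓ t = CaptLe k ℓ t × (∀ s → CaptLe k ℓ s → t ≤ s)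

  -- lim_{ℓ→∞} capt_k(G, ℓ) = L  (an ℕ-valued sequence converges to L
  -- iff it is eventually equal to L)
  LimCapt : (k L : ℕ) → Set
  LimCapt k L = Σ ℕ λ N → ∀ ℓ → N ≤ ℓ → IsCapt k ℓ L

  -- strong k-cop-win: the limit exists and is finite
  StrongCopWin : ℕ → Set
  StrongCopWin k = Σ ℕ λ L → LimCapt k L

data KAdj {m n : ℕ} : Fin m ⊎ Fin n → Fin m ⊎ Fin n → Set where
  loop : ∀ {v} → KAdj v v
  lr   : ∀ {a b} → KAdj (inj₁ a) (inj₂ b)
  rl   : ∀ {a b} → KAdj (inj₂ b) (inj₁ a)

KAdj-sym : ∀ {m n} {u v : Fin m ⊎ Fin n} → KAdj u v → KAdj v u
KAdj-sym loop = loop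
KAdj-sym lr   = rl
KAdj-sym rl   = lr

K : ℕ → ℕ → Graph
K m n = record
  { V      = Fin m ⊎ Fin n
  ; _~_    = KAdj
  ; ~-refl = λ _ → loop
  ; ~-sym  = KAdj-sym
  ; _≟_    = ≡-dec _≟ᶠ_ _≟ᶠ_
  }

⌈_/_⌉ : (n m : ℕ) → .{{NonZero m}} → ℕ
⌈ n / m ⌉ = (n + m ∸ 1) / m

{-# OPTIONS --safe #-}
module Submission where

-- With k < m cops, a cop move x → y meets each side of K_{m,n} in at most one vertex, so every
-- vertex has a neighbour on the other side that is cop-free both before and after the cops move.
-- Robbers that follow all (m+n)^(t+1) plans of length t+1 thus keep, for every cop-free vertex and
-- every continuation, a robber there whose remaining plan is that continuation; some robber
-- survives t rounds, for every t, so capt_k(K_{m,n}, ℓ) is unbounded in ℓ.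
--
-- With m cops and n > m, the cops sweep the n-side in blocks of m vertices, visiting the whole
-- m-side between two blocks: robbers can then never get back behind the sweep, which ends after
-- 2⌈n/m⌉ − 2 rounds. Conversely, robbers sitting still on the whole n-side force this: a cop
-- enters a new vertex of the n-side at most every second round, so in s rounds the m cops see at
-- most m(1 + ⌊s/2⌋) of them. For n = m the cops simply start on one side and step to the other.

open import Defs
open import Data.Nat
  using (ℕ; zero; suc; _≤_; _<_; _∸_; _*_; _+_; _^_; ⌊_/2⌋; ⌈_/2⌉; NonZero; >-nonZero; z≤n; s≤s; s≤s⁻¹)
open import Data.Nat.Properties
  using ( ≤-refl; ≤-reflexive; ≤-trans; <-irrefl; ≤-<-trans; <-≤-trans; ≮⇒≥; ≰⇒>; <⇒≱; 1+n≰n; n<1+n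
        ; n≤1+n; m≤m+n; m≤n+m; m<m+n; m≤n⇒m<n∨m≡n; +-suc; +-comm; +-assoc; +-identityʳ; *-comm
        ; *-identityʳ; +-monoˡ-≤; +-monoʳ-≤; +-monoʳ-<; *-monoʳ-≤; m+[n∸m]≡n; m+n∸m≡n
        ; ∸-monoˡ-<; m^n≢0; ⌊n/2⌋-mono; ⌊n/2⌋≤⌈n/2⌉; n≡⌊n+n/2⌋; n≡⌈n+n/2⌉; module ≤-Reasoning)
open import Data.Nat.DivMod using (_/_; _mod_; m<n⇒m%n≡m; m<n*o⇒m/o<n; m*n/n≡m; /-monoˡ-≤)
open import Data.Fin using (Fin; zero; suc; toℕ; fromℕ<; inject≤; splitAt; join; finToFun; funToFin)
open import Data.Fin.Properties
  using ( any?; pigeonhole; ¬∀⟶∃¬; toℕ-injective; toℕ-fromℕ<; toℕ-inject≤; toℕ<n; join-splitAt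
        ; splitAt-join; finToFun-funToFin)
  renaming (_≟_ to _≟ᶠ_)
open import Data.Sum using (_⊎_; inj₁; inj₂; swap)
open import Data.Maybe as Maybe using (just; nothing)
open import Data.Vec.Functional using (Vector; _∷_; head; tail)
open import Data.Product using (∃; _×_; _,_; proj₁; proj₂)
open import Data.List using (List; []; [_]; length; _++_; concat; tabulate; lookup)
open import Data.List.Properties using (length-++)
open import Data.List.Relation.Unary.Any using (here; index)
open import Data.List.Relation.Unary.Any.Properties using (lookup-index)
open import Data.List.Membership.Propositional using (_∈_; _∉_)
open import Data.List.Membership.Propositional.Properties using (∈-++⁺ˡ; ∈-++⁺ʳ; ∈-concat⁺′; ∈-tabulate⁺)
import Data.List.Membership.DecPropositional as DecMembership
open import Data.Empty using (⊥; ⊥-elim)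
open import Function using (_∘_)
open import Relation.Nullary using (¬_; yes; no)
open import Relation.Binary.PropositionalEquality
  using (_≡_; _≢_; _≗_; refl; sym; trans; cong; subst; module ≡-Reasoning)

∃-∉ : ∀ {n} (xs : List (Fin n)) → length xs < n → ∃ (_∉ xs)
∃-∉ {n} xs |xs|<n = ¬∀⟶∃¬ n (_∈ xs) (_∈? xs) ¬all∈
  where
  open DecMembership (_≟ᶠ_ {n}) using (_∈?_)
  ¬all∈ : ¬ (∀ b → b ∈ xs)
  ¬all∈ all∈ with pigeonhole |xs|<n (index ∘ all∈)
  ... | i , j , i<j , same = <-irrefl (cong toℕ i≡j) i<j
    where
    i≡j : i ≡ j
    i≡j = trans (lookup-index (all∈ i)) (trans (cong (lookup xs) same) (sym (lookup-index (all∈ j))))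

length-++-≤ : ∀ {A : Set} (xs : List A) {ys a b} → length xs + a ≤ b → length ys ≤ a → length (xs ++ ys) ≤ b
length-++-≤ xs {ys} xs+a≤b ys≤a =
  subst (_≤ _) (sym (length-++ xs {ys})) (≤-trans (+-monoʳ-≤ (length xs) ys≤a) xs+a≤b)

length-concat-tabulate-≤ : ∀ {A : Set} {k a} (xss : Fin k → List A) → (∀ i → length (xss i) ≤ a) →
                           length (concat (tabulate xss)) ≤ k * a
length-concat-tabulate-≤ {k = zero}  xss short = z≤n
length-concat-tabulate-≤ {k = suc k} xss short =
  length-++-≤ (xss zero) (+-monoˡ-≤ _ (short zero)) (length-concat-tabulate-≤ (xss ∘ suc) (short ∘ suc))

∃-∉-all : ∀ {n k a} (xss : Fin k → List (Fin n)) → (∀ i → length (xss i) ≤ a) → k * a < n →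
          ∃ λ b → ∀ i → b ∉ xss i
∃-∉-all xss short k*a<n
  with ∃-∉ (concat (tabulate xss)) (≤-<-trans (length-concat-tabulate-≤ xss short) k*a<n)
... | b , b∉ = b , λ i b∈ → b∉ (∈-concat⁺′ b∈ (∈-tabulate⁺ i))

mod-toℕ : ∀ {n} .{{_ : NonZero n}} (b : Fin n) → toℕ b mod n ≡ b
mod-toℕ b = toℕ-injective (trans (toℕ-fromℕ< _) (m<n⇒m%n≡m (toℕ<n b)))

mod-surjective : ∀ {p ℓ} .{{_ : NonZero p}} → p ≤ ℓ → ∀ (b : Fin p) → ∃ λ (j : Fin ℓ) → toℕ j mod p ≡ b
mod-surjective {p} p≤ℓ b = inject≤ b p≤ℓ , trans (cong (_mod p) (toℕ-inject≤ b p≤ℓ)) (mod-toℕ b)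

n≤p*m⇒⌈n/m⌉≤p : ∀ {n m} .{{_ : NonZero m}} p → n ≤ p * m → ⌈ n / m ⌉ ≤ p
n≤p*m⇒⌈n/m⌉≤p {n} {suc m'} p n≤p*m = s≤s⁻¹ (m<n*o⇒m/o<n (begin-strict
  n + suc m' ∸ 1      ≡⟨ cong (_∸ 1) (+-suc n m') ⟩
  n + m'              ≤⟨ +-monoˡ-≤ m' n≤p*m ⟩
  p * suc m' + m'     <⟨ +-monoʳ-< (p * suc m') (n<1+n m') ⟩
  p * suc m' + suc m' ≡⟨ +-comm (p * suc m') (suc m') ⟩
  suc p * suc m'      ∎))
  where open ≤-Reasoning

p*m<n⇒p<⌈n/m⌉ : ∀ {n m} .{{_ : NonZero m}} p → p * m < n → p < ⌈ n / m ⌉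
p*m<n⇒p<⌈n/m⌉ {n} {suc m'} p p*m<n = begin
  suc p                   ≡⟨ m*n/n≡m (suc p) (suc m') ⟨
  suc p * suc m' / suc m' ≤⟨ /-monoˡ-≤ (suc m') (begin
    suc p * suc m'          ≡⟨ +-comm (suc m') (p * suc m') ⟩
    p * suc m' + suc m'     ≡⟨ +-suc (p * suc m') m' ⟩
    suc (p * suc m') + m'   ≤⟨ +-monoˡ-≤ m' p*m<n ⟩
    n + m'                  ≡⟨ cong (_∸ 1) (+-suc n m') ⟨
    n + suc m' ∸ 1          ∎) ⟩
  ⌈ n / suc m' ⌉          ∎
  where open ≤-Reasoning

⌈n/m⌉-bounds : ∀ n m .{{_ : NonZero m}} → 0 < n → ∃ λ Q → ⌈ n / m ⌉ ≡ suc Q × Q * m < n × n ≤ suc Q * m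
-- The second scrutinee, 0 < ⌈ n / m ⌉, rules out the case ⌈ n / m ⌉ = 0.
⌈n/m⌉-bounds n m 0<n with ⌈ n / m ⌉ in q≡ | p*m<n⇒p<⌈n/m⌉ {n} {m} 0 0<n
... | suc Q | _ = Q , refl , Q*m<n , n≤[1+Q]*m
  where
  Q*m<n : Q * m < n
  Q*m<n = ≰⇒> λ n≤Q*m → 1+n≰n (subst (_≤ Q) q≡ (n≤p*m⇒⌈n/m⌉≤p Q n≤Q*m))
  n≤[1+Q]*m : n ≤ suc Q * m
  n≤[1+Q]*m = ≮⇒≥ λ [1+Q]*m<n → <-irrefl (sym q≡) (p*m<n⇒p<⌈n/m⌉ (suc Q) [1+Q]*m<n)

2*[1+n]∸2≡n+n : ∀ n → 2 * suc n ∸ 2 ≡ n + n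
2*[1+n]∸2≡n+n n = cong (_∸ 1) (trans (+-suc n (n + 0)) (cong (λ x → suc (n + x)) (+-identityʳ n)))

Free : ∀ {V : Set} {k} → (Fin k → V) → V → Set
Free c v = ∀ i → c i ≢ v

module GameProperties (G : Graph) where
  open Graph G
  open Game G

  capture-free : ∀ {k ℓ} (c : Cops k) (r : Robbers ℓ) j {v} → r j ≡ just v → Free c v →
                 capture c r j ≡ just v
  capture-free c r j r≡v free with r j
  capture-free c r j refl free | just v with any? (λ i → c i ≟ v)
  ... | yes (i , ci≡v) = ⊥-elim (free i ci≡v)
  ... | no _           = refl

  capture-alive : ∀ {k ℓ} (c : Cops k) (r : Robbers ℓ) j {v} → capture c r j ≡ just v →
                  r j ≡ just v × Free c v
  capture-alive c r j alive with r j
  ... | just u with any? (λ i → c i ≟ u)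
  capture-alive c r j refl | just u | no none = refl , λ i ci≡u → none (i , ci≡u)

  caught-≢-just : ∀ {ℓ} {r : Robbers ℓ} → AllCaught r → ∀ j {v} → r j ≢ just v
  caught-≢-just caught j rj with trans (sym (caught j)) rj
  ... | ()

  RStep-just⁻ : ∀ {x v} → RStep x (just v) → ∃ λ u → x ≡ just u × u ~ v
  RStep-just⁻ (step u~v) = _ , refl , u~v

  RobMove-refl : ∀ {ℓ} (r : Robbers ℓ) → RobMove r r
  RobMove-refl r j with r j
  ... | nothing = out
  ... | just v  = step (~-refl v)

  Confined : ∀ {ℓ} → (V → Set) → Robbers ℓ → Set
  Confined P r = ∀ j {v} → r j ≡ just v → P v

  confined-placement : ∀ {k ℓ} {P : V → Set} (c : Cops k) (r₀ : Fin ℓ → V) → (∀ {v} → Free c v → P v) →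
                       Confined P (capture c (just ∘ r₀))
  confined-placement c r₀ region j alive = region (proj₂ (capture-alive c (just ∘ r₀) j alive))

  confined-round : ∀ {k ℓ} {P Q : V → Set} (c' : Cops k) {r r' : Robbers ℓ} →
                   (∀ {u v} → P u → Free c' u → u ~ v → Free c' v → Q v) →
                   Confined P r → RobMove (capture c' r) r' → Confined Q (capture c' r')
  confined-round c' {r} {r'} region confined moves j alive
    with capture-alive c' r' j alive
  ... | r'j , free-v with RStep-just⁻ (subst (RStep _) r'j (moves j))
  ... | u , was-u , u~v with capture-alive c' r j was-u
  ... | rj , free-u = region (confined j rj) free-u u~v free-v

  confined-caught : ∀ {ℓ} {P : V → Set} {r : Robbers ℓ} → (∀ v → ¬ P v) → Confined P r → AllCaught r
  confined-caught {r = r} empty confined j with r j in rj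
  ... | nothing = refl
  ... | just v  = ⊥-elim (empty v (confined j rj))

  capt-positive : ∀ {k ℓ} → (∀ (c : Cops k) → ∃ (Free c)) → ¬ CaptLe k (suc ℓ) 0
  capt-positive {ℓ = ℓ} free (c₀ , win) with free c₀
  ... | v , free-v = caught-≢-just (win (λ _ → v)) zero (capture-free c₀ everyone-at-v zero refl free-v)
    where
    everyone-at-v : Robbers (suc ℓ)
    everyone-at-v _ = just v

  limit-from-bounds : ∀ {k L} N → (∀ ℓ → N ≤ ℓ → CaptLe k ℓ L) →
                      (∀ ℓ → N ≤ ℓ → ∀ s → s < L → ¬ CaptLe k ℓ s) → LimCapt k L
  limit-from-bounds N upper lower =
    N , λ ℓ N≤ℓ → upper ℓ N≤ℓ , λ s capt → ≮⇒≥ (λ s<L → lower ℓ N≤ℓ s s<L capt)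

KAdj-inj₂⁻ : ∀ {m n} {b b' : Fin n} → KAdj {m} (inj₂ b) (inj₂ b') → b ≡ b'
KAdj-inj₂⁻ loop = refl

KAdj-swap : ∀ {m n} {u v : Fin m ⊎ Fin n} → KAdj u v → KAdj (swap u) (swap v)
KAdj-swap loop = loop
KAdj-swap lr   = rl
KAdj-swap rl   = lr

onB : ∀ {m n} → Fin m ⊎ Fin n → List (Fin n)
onB (inj₁ _) = []
onB (inj₂ b) = [ b ]

∉-onB : ∀ {m n} {b : Fin n} (x : Fin m ⊎ Fin n) → b ∉ onB x → x ≢ inj₂ b
∉-onB (inj₂ _) b∉ refl = b∉ (here refl)

-- Since x ~ y, the move x → y meets the side Fin n in at most one vertex.
touchedB : ∀ {m n} → Fin m ⊎ Fin n → Fin m ⊎ Fin n → List (Fin n)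
touchedB (inj₁ _) y = onB y
touchedB (inj₂ b) _ = [ b ]

length-touchedB : ∀ {m n} (x y : Fin m ⊎ Fin n) → length (touchedB x y) ≤ 1
length-touchedB (inj₁ _) (inj₁ _) = z≤n
length-touchedB (inj₁ _) (inj₂ _) = ≤-refl
length-touchedB (inj₂ _) _        = ≤-refl

∉-touchedB : ∀ {m n} {x y : Fin m ⊎ Fin n} {b} → KAdj x y → b ∉ touchedB x y → x ≢ inj₂ b × y ≢ inj₂ b
∉-touchedB {x = inj₁ _}  _   b∉ = (λ ()) , ∉-onB _ b∉
∉-touchedB {x = inj₂ b'} x~y b∉ = ∉-onB (inj₂ b') b∉ , λ { refl → b∉ (here (sym (KAdj-inj₂⁻ x~y))) }

∃-free-inj₂ : ∀ {m n k} {c c' : Fin k → Fin m ⊎ Fin n} → k < n → (∀ i → KAdj (c i) (c' i)) →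
              ∃ λ b → Free c (inj₂ b) × Free c' (inj₂ b)
∃-free-inj₂ {c = c} {c'} k<n moves
  with ∃-∉-all (λ i → touchedB (c i) (c' i)) (λ i → length-touchedB (c i) (c' i))
               (subst (_< _) (sym (*-identityʳ _)) k<n)
... | b , b∉ = b , (λ i → proj₁ (∉-touchedB (moves i) (b∉ i))) , (λ i → proj₂ (∉-touchedB (moves i) (b∉ i)))

∃-free-inj₁ : ∀ {m n k} {c c' : Fin k → Fin m ⊎ Fin n} → k < m → (∀ i → KAdj (c i) (c' i)) →
              ∃ λ a → Free c (inj₁ a) × Free c' (inj₁ a)
∃-free-inj₁ {c = c} {c'} k<m moves with ∃-free-inj₂ {c = swap ∘ c} {swap ∘ c'} k<m (KAdj-swap ∘ moves)
... | a , free , free' = a , (λ i → free i ∘ cong swap) , (λ i → free' i ∘ cong swap)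

∃-free : ∀ {m n k} → k < m + n → (c : Fin k → Fin m ⊎ Fin n) → ∃ (Free c)
∃-free {m} {n} k<m+n c
  with ∃-∉-all (λ i → [ join m n (c i) ]) (λ _ → ≤-refl) (subst (_< m + n) (sym (*-identityʳ _)) k<m+n)
... | x , x∉ =
  splitAt m x , λ i ci≡x → x∉ i (here (sym (trans (cong (join m n) ci≡x) (join-splitAt m n x))))

towards : ∀ {m n} → Fin m ⊎ Fin n → Fin m ⊎ Fin n → Fin m ⊎ Fin n
towards (inj₁ _) (inj₂ b) = inj₂ b
towards (inj₂ _) (inj₁ a) = inj₁ a
towards u        _        = u

KAdj-towards : ∀ {m n} (u w : Fin m ⊎ Fin n) → KAdj u (towards u w)
KAdj-towards (inj₁ _) (inj₁ _) = loop
KAdj-towards (inj₁ _) (inj₂ _) = lr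
KAdj-towards (inj₂ _) (inj₁ _) = rl
KAdj-towards (inj₂ _) (inj₂ _) = loop

∃-free-across : ∀ {m n k} {c c' : Fin k → Fin m ⊎ Fin n} → k < m → k < n → (∀ i → KAdj (c i) (c' i)) →
                ∀ w → ∃ λ v → towards v w ≡ w × Free c v × Free c' v
∃-free-across k<m k<n moves (inj₁ _) with ∃-free-inj₂ k<n moves
... | b , free , free' = inj₂ b , refl , free , free'
∃-free-across k<m k<n moves (inj₂ _) with ∃-free-inj₁ k<m moves
... | a , free , free' = inj₁ a , refl , free , free'

module Bipartite (m n : ℕ) where
  open Game (K m n) public
  open GameProperties (K m n) public

  V : Set
  V = Fin m ⊎ Fin n

  module PlannedRobbers {k ℓ : ℕ} (k<m : k < m) (k<n : k < n) where
    Covers : ∀ {t} → Cops k → Robbers ℓ → (Fin ℓ → Vector V t) → Set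
    Covers c r plan = ∀ v → Free c v → ∀ ws → ∃ λ j → r j ≡ just v × plan j ≗ ws

    follow : ∀ {t} → (Fin ℓ → Vector V (suc t)) → Robbers ℓ → Robbers ℓ
    follow plan r j = Maybe.map (λ u → towards u (head (plan j))) (r j)

    RobMove-follow : ∀ {t} (plan : Fin ℓ → Vector V (suc t)) r → RobMove r (follow plan r)
    RobMove-follow plan r j with r j
    ... | nothing = out
    ... | just u  = step (KAdj-towards u (head (plan j)))

    covers-round : ∀ {t c c' r} (plan : Fin ℓ → Vector V (suc t)) → Covers c r plan → CopMove c c' →
                   Covers c' (capture c' (follow plan (capture c' r))) (tail ∘ plan)
    covers-round {c' = c'} {r} plan covers moves w free-w ws with ∃-free-across k<m k<n moves w
    ... | v , v→w , free-v , free'-v with covers v free-v (w ∷ ws)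
    ... | j , rj , plan-j = j , capture-free c' (follow plan (capture c' r)) j r'j free-w , plan-j ∘ suc
      where
      open ≡-Reasoning
      r'j : follow plan (capture c' r) j ≡ just w
      r'j = begin
        Maybe.map (λ u → towards u (head (plan j))) (capture c' r j)
          ≡⟨ cong (Maybe.map _) (capture-free c' r j rj free'-v) ⟩
        just (towards v (head (plan j))) ≡⟨ cong (just ∘ towards v) (plan-j zero) ⟩
        just (towards v w)               ≡⟨ cong just v→w ⟩
        just w                           ∎

    covers-escape : ∀ t {c r} (plan : Fin ℓ → Vector V t) → Covers c r plan → ¬ WinIn t c r
    covers-escape zero {c} plan covers caught with ∃-free (<-≤-trans k<m (m≤m+n m n)) c
    ... | v , free-v with covers v free-v (λ ())
    ... | j , rj , _ = caught-≢-just caught j rj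
    covers-escape (suc t) {c} {r} plan covers (c' , moves , win) =
      covers-escape t (tail ∘ plan) (covers-round plan covers moves)
        (win _ (RobMove-follow plan (capture c' r)))

    plans-escape : ∀ {t} (plan : Fin ℓ → Vector V (suc t)) → (∀ ws → ∃ λ j → plan j ≗ ws) →
                   ¬ CaptLe k ℓ t
    plans-escape {t} plan exhaustive (c₀ , win) = covers-escape t (tail ∘ plan) covers (win (head ∘ plan))
      where
      covers : Covers c₀ (capture c₀ (just ∘ head ∘ plan)) (tail ∘ plan)
      covers v free-v ws with exhaustive (v ∷ ws)
      ... | j , plan-j =
        j , capture-free c₀ (just ∘ head ∘ plan) j (cong just (plan-j zero)) free-v , plan-j ∘ suc

  ∃-exhaustive-plans : ∀ {ℓ T} → 0 < m + n → (m + n) ^ T ≤ ℓ →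
                       ∃ λ (plan : Fin ℓ → Vector V T) → ∀ ws → ∃ λ j → plan j ≗ ws
  ∃-exhaustive-plans {ℓ} {T} 0<m+n bound = plan , exhaustive
    where
    instance
      nonZero : NonZero ((m + n) ^ T)
      nonZero = m^n≢0 (m + n) T {{>-nonZero 0<m+n}}
    plan : Fin ℓ → Vector V T
    plan j = splitAt m ∘ finToFun (toℕ j mod ((m + n) ^ T))
    exhaustive : ∀ ws → ∃ λ j → plan j ≗ ws
    exhaustive ws with mod-surjective bound (funToFin (join m n ∘ ws))
    ... | j , code = j , λ i → begin
      splitAt m (finToFun (toℕ j mod ((m + n) ^ T)) i)
        ≡⟨ cong (λ x → splitAt m (finToFun x i)) code ⟩
      splitAt m (finToFun (funToFin (join m n ∘ ws)) i)
        ≡⟨ cong (splitAt m) (finToFun-funToFin (join m n ∘ ws) i) ⟩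
      splitAt m (join m n (ws i))
        ≡⟨ splitAt-join m n (ws i) ⟩
      ws i
        ∎
      where open ≡-Reasoning

  few-cops-not-strong : ∀ {k} → k < m → k < n → ¬ StrongCopWin k
  few-cops-not-strong {k} k<m k<n (L , N , limit)
    with ∃-exhaustive-plans {N + (m + n) ^ suc L} (≤-trans (≤-trans (s≤s z≤n) k<m) (m≤m+n m n)) (m≤n+m _ N)
  ... | plan , exhaustive =
    PlannedRobbers.plans-escape k<m k<n plan exhaustive (proj₁ (limit _ (m≤m+n N _)))

  -- A cop at x can still step onto at most budget t x new vertices of Fin n in t rounds,
  -- since between two of them it has to visit Fin m.
  budget : ℕ → V → ℕ
  budget t (inj₁ _) = ⌈ t /2⌉
  budget t (inj₂ _) = ⌊ t /2⌋

  entered : V → V → List (Fin n)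
  entered (inj₁ _) y = onB y
  entered (inj₂ _) _ = []

  onB-budget : ∀ t y → length (onB y) + budget t y ≤ suc ⌊ t /2⌋
  onB-budget t (inj₁ _) = ⌊n/2⌋-mono (n≤1+n (suc t))
  onB-budget t (inj₂ _) = ≤-refl

  entered-budget : ∀ t {x y} → KAdj x y → length (entered x y) + budget t y ≤ budget (suc t) x
  entered-budget t {inj₁ _} {y}      _ = onB-budget t y
  entered-budget t {inj₂ _} {inj₁ _} _ = ≤-refl
  entered-budget t {inj₂ _} {inj₂ _} _ = ⌊n/2⌋≤⌈n/2⌉ t

  ∉-entered : ∀ {x y b} → KAdj x y → x ≢ inj₂ b → b ∉ entered x y → y ≢ inj₂ b
  ∉-entered {inj₁ _} _   _   b∉   = ∉-onB _ b∉
  ∉-entered {inj₂ _} x~y x≢b _ refl = x≢b (cong inj₂ (KAdj-inj₂⁻ x~y))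

  module StaticRobbers {k ℓ : ℕ} where
    -- Counting by lists: more occupied cop-free vertices of Fin n remain than the cops can still visit.
    Unseen : ℕ → Cops k → Robbers ℓ → Set
    Unseen t c r = ∀ (xss : Fin k → List (Fin n)) → (∀ i → length (xss i) ≤ budget t (c i)) →
                   ∃ λ b → (∀ i → b ∉ xss i) × Free c (inj₂ b) × ∃ λ j → r j ≡ just (inj₂ b)

    unseen-round : ∀ {t c c' r} → Unseen (suc t) c r → CopMove c c' → Unseen t c' (capture c' r)
    unseen-round {t} {c} {c'} {r} unseen moves xss short
      with unseen (λ i → entered (c i) (c' i) ++ xss i)
                  (λ i → length-++-≤ (entered (c i) (c' i)) (entered-budget t (moves i)) (short i))
    ... | b , b∉ , free , j , rj = b , (λ i → b∉ i ∘ ∈-++⁺ʳ _) , free' , j , capture-free c' r j rj free'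
      where
      free' : Free c' (inj₂ b)
      free' i = ∉-entered (moves i) (free i) (b∉ i ∘ ∈-++⁺ˡ)

    unseen-capture : ∀ {t c r} → Unseen t c r → Unseen t c (capture c r)
    unseen-capture {c = c} {r} unseen xss short with unseen xss short
    ... | b , b∉ , free , j , rj = b , b∉ , free , j , capture-free c r j rj free

    unseen-escape : ∀ t {c r} → Unseen t c r → ¬ WinIn t c r
    unseen-escape zero unseen caught with unseen (λ _ → []) (λ _ → z≤n)
    ... | _ , _ , _ , j , rj = caught-≢-just caught j rj
    unseen-escape (suc t) {r = r} unseen (c' , moves , win) =
      unseen-escape t (unseen-capture (unseen-round unseen moves)) (win (capture c' r) (RobMove-refl _))

    static-escape : ∀ {s} → k * suc ⌊ s /2⌋ < n → n ≤ ℓ → ¬ CaptLe k ℓ s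
    static-escape {s} bound n≤ℓ (c₀ , win) = unseen-escape s unseen₀ (win r₀)
      where
      instance
        nonZero : NonZero n
        nonZero = >-nonZero (≤-<-trans z≤n bound)
      r₀ : Fin ℓ → V
      r₀ j = inj₂ (toℕ j mod n)
      unseen₀ : Unseen s c₀ (capture c₀ (just ∘ r₀))
      unseen₀ xss short
        with ∃-∉-all (λ i → onB (c₀ i) ++ xss i)
                     (λ i → length-++-≤ (onB (c₀ i)) (onB-budget s (c₀ i)) (short i)) bound
      ... | b , b∉ with mod-surjective n≤ℓ b
      ... | j , j↦b = b , (λ i → b∉ i ∘ ∈-++⁺ʳ _) , free , j ,
                      capture-free c₀ (just ∘ r₀) j (cong (just ∘ inj₂) j↦b) free
        where
        free : Free c₀ (inj₂ b)
        free i = ∉-onB (c₀ i) (b∉ i ∘ ∈-++⁺ˡ)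

  module Sweep .{{_ : NonZero n}} where
    allA : Cops m
    allA = inj₁

    -- Cops on the vertices d, …, d + m − 1 of Fin n (wrapping around modulo n, which is harmless).
    block : ℕ → Cops m
    block d i = inj₂ ((d + toℕ i) mod n)

    block-covers : ∀ d (b : Fin n) → d ≤ toℕ b → toℕ b < d + m → ∃ λ i → block d i ≡ inj₂ b
    block-covers d b d≤b b<d+m = fromℕ< offset<m , cong inj₂ (begin
      (d + toℕ (fromℕ< offset<m)) mod n ≡⟨ cong (λ x → (d + x) mod n) (toℕ-fromℕ< offset<m) ⟩
      (d + (toℕ b ∸ d)) mod n           ≡⟨ cong (_mod n) (m+[n∸m]≡n d≤b) ⟩
      toℕ b mod n                       ≡⟨ mod-toℕ b ⟩
      b                                 ∎)
      where
      open ≡-Reasoning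
      offset<m : toℕ b ∸ d < m
      offset<m = subst (toℕ b ∸ d <_) (m+n∸m≡n d m) (∸-monoˡ-< b<d+m d≤b)

    beyond-block : ∀ d {b} → Free (block d) (inj₂ b) → d ≤ toℕ b → d + m ≤ toℕ b
    beyond-block d {b} free d≤b = ≮⇒≥ λ b<d+m →
      let i , covered = block-covers d b d≤b b<d+m in free i covered

    Uncleared : ℕ → V → Set
    Uncleared d (inj₁ _) = ⊥
    Uncleared d (inj₂ b) = d ≤ toℕ b

    -- The vertices within one step of an uncleared vertex.
    NearUncleared : ℕ → V → Set
    NearUncleared d (inj₁ _) = d < n
    NearUncleared d (inj₂ b) = d ≤ toℕ b

    uncleared-empty : ∀ {d} → n ≤ d → ∀ v → ¬ Uncleared d v
    uncleared-empty n≤d (inj₂ b) d≤b = <⇒≱ (toℕ<n b) (≤-trans n≤d d≤b)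

    near-uncleared-empty : ∀ {d} → n ≤ d → ∀ v → ¬ NearUncleared d v
    near-uncleared-empty n≤d (inj₁ _) d<n = <⇒≱ d<n n≤d
    near-uncleared-empty n≤d (inj₂ b) d≤b = uncleared-empty n≤d (inj₂ b) d≤b

    to-block : ∀ d {u v} → Uncleared d u → Free (block d) u → KAdj u v → Free (block d) v →
               NearUncleared (d + m) v
    to-block d {inj₂ b} {inj₁ _} d≤b free _    _ = ≤-<-trans (beyond-block d free d≤b) (toℕ<n b)
    to-block d {inj₂ b} {inj₂ _} d≤b free loop _ = beyond-block d free d≤b

    to-A : ∀ d {u v} → NearUncleared d u → Free allA u → KAdj u v → Free allA v → Uncleared d v
    to-A d {inj₁ a}          _   free _    _     = ⊥-elim (free a refl)
    to-A d {inj₂ _} {inj₁ a} _   _    _    free' = ⊥-elim (free' a refl)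
    to-A d {inj₂ _} {inj₂ _} d≤b _    loop _     = d≤b

    mutual
      win-from-A : ∀ t d {ℓ} {r : Robbers ℓ} → n ≤ d + ⌈ t /2⌉ * m → Confined (Uncleared d) r →
                   WinIn t allA r
      win-from-A zero    d n≤d   confined =
        confined-caught (uncleared-empty (subst (n ≤_) (+-identityʳ d) n≤d)) confined
      win-from-A (suc t) d bound confined = block d , (λ _ → lr) , λ _ moves →
        win-from-B t (d + m) (block d) (λ _ → rl) (subst (n ≤_) (sym (+-assoc d m _)) bound)
          (confined-round (block d) (to-block d) confined moves)

      win-from-B : ∀ t d {ℓ} {r : Robbers ℓ} (c : Cops m) → CopMove c allA → n ≤ d + ⌊ t /2⌋ * m →
                   Confined (NearUncleared d) r → WinIn t c r
      win-from-B zero    d c _   n≤d   confined =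
        confined-caught (near-uncleared-empty (subst (n ≤_) (+-identityʳ d) n≤d)) confined
      win-from-B (suc t) d c c→A bound confined = allA , c→A , λ _ moves →
        win-from-A t d bound (confined-round allA (to-A d) confined moves)

    capt-from-A : ∀ {ℓ} t → n ≤ ⌈ t /2⌉ * m → CaptLe m ℓ t
    capt-from-A t bound = allA , λ r₀ → win-from-A t 0 bound (confined-placement allA r₀ start)
      where
      start : ∀ {v} → Free allA v → Uncleared 0 v
      start {inj₁ a} free = free a refl
      start {inj₂ _} _    = z≤n

    capt-from-block : ∀ {ℓ} t → m < n → n ≤ suc ⌊ t /2⌋ * m → CaptLe m ℓ t
    capt-from-block t m<n bound =
      block 0 , λ r₀ → win-from-B t m (block 0) (λ _ → rl) bound (confined-placement (block 0) r₀ start)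
      where
      start : ∀ {v} → Free (block 0) v → NearUncleared m v
      start {inj₁ _} _    = m<n
      start {inj₂ _} free = beyond-block 0 free z≤n

    limit-one : 0 < n → n ≤ m → LimCapt m 1
    limit-one 0<n n≤m =
      limit-from-bounds 1 (λ _ _ → capt-from-A 1 (subst (n ≤_) (sym (+-identityʳ m)) n≤m)) lower
      where
      lower : ∀ ℓ → 1 ≤ ℓ → ∀ s → s < 1 → ¬ CaptLe m ℓ s
      lower (suc _) _ zero    _ = capt-positive (∃-free (m<m+n m 0<n))
      lower _       _ (suc _) (s≤s ())

    limit-sweep : ∀ Q → m < n → Q * m < n → n ≤ suc Q * m → LimCapt m (Q + Q)
    limit-sweep Q m<n Q*m<n n≤[1+Q]*m = limit-from-bounds n
      (λ _ _ → capt-from-block (Q + Q) m<n (subst (λ x → n ≤ suc x * m) (n≡⌊n+n/2⌋ Q) n≤[1+Q]*m))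
      (λ _ n≤ℓ s s<Q+Q → StaticRobbers.static-escape (bound s s<Q+Q) n≤ℓ)
      where
      bound : ∀ s → s < Q + Q → m * suc ⌊ s /2⌋ < n
      bound s s<Q+Q = begin-strict
        m * suc ⌊ s /2⌋ ≤⟨ *-monoʳ-≤ m 1+⌊s/2⌋≤Q ⟩
        m * Q           ≡⟨ *-comm m Q ⟩
        Q * m           <⟨ Q*m<n ⟩
        n               ∎
        where
        open ≤-Reasoning
        -- ⌊ (s + 2) / 2 ⌋ ≤ ⌊ (Q + Q + 1) / 2 ⌋ = ⌈ (Q + Q) / 2 ⌉ = Q
        1+⌊s/2⌋≤Q : suc ⌊ s /2⌋ ≤ Q
        1+⌊s/2⌋≤Q = subst (suc ⌊ s /2⌋ ≤_) (sym (n≡⌈n+n/2⌉ Q)) (⌊n/2⌋-mono (s≤s s<Q+Q))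

    limit-ceiling : .{{_ : NonZero m}} → m < n → LimCapt m (2 * ⌈ n / m ⌉ ∸ 2)
    limit-ceiling m<n with ⌈n/m⌉-bounds n m (≤-trans (s≤s z≤n) m<n)
    ... | Q , q≡1+Q , Q*m<n , n≤[1+Q]*m =
      subst (LimCapt m) (sym (trans (cong (λ q → 2 * q ∸ 2) q≡1+Q) (2*[1+n]∸2≡n+n Q)))
        (limit-sweep Q m<n Q*m<n n≤[1+Q]*m)

proposition4p10 : ∀ (m n : ℕ) → .{{_ : NonZero m}} → m ≤ n →
    Game.StrongCopWin (K m n) m
    × (∀ k → 1 ≤ k → k ≤ m ∸ 1 → ¬ Game.StrongCopWin (K m n) k)
    × (m < n → Game.LimCapt (K m n) m (2 * ⌈ n / m ⌉ ∸ 2))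
    × (n ≡ m → Game.LimCapt (K m n) m 1)
proposition4p10 m@(suc _) n m≤n = strong , not-strong , limit-ceiling , limit-n≡m
  where
  open Bipartite m n
  0<n : 0 < n
  0<n = ≤-trans (s≤s z≤n) m≤n
  instance
    nonZero : NonZero n
    nonZero = >-nonZero 0<n
  open Sweep

  limit-n≡m : n ≡ m → LimCapt m 1
  limit-n≡m n≡m = limit-one 0<n (≤-reflexive n≡m)

  strong : StrongCopWin m
  strong with m≤n⇒m<n∨m≡n m≤n
  ... | inj₁ m<n = _ , limit-ceiling m<n
  ... | inj₂ m≡n = _ , limit-n≡m (sym m≡n)

  not-strong : ∀ k → 1 ≤ k → k ≤ m ∸ 1 → ¬ StrongCopWin k
  not-strong k _ k≤m-1 = few-cops-not-strong (s≤s k≤m-1) (<-≤-trans (s≤s k≤m-1) m≤n)
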